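{- Let $p>2$ be a prime, $D$ an integer with $D\not\equiv 0\pmod p$, and $\xi\in(0,1)$. Then for any distinct $g,g'\in\mathbb{Z}_p$ there are at least $\xi\cdot(p-1)$ values $c\not\equiv 0\pmod p$ such that \[ \mathrm{dist}_{p,D}(c g\bmod p,\ c g'\bmod p) > (1-\xi)\cdot\frac{p-1}{2}. \]
   Context: For $g_0,g_1\in\mathbb{Z}_p$, $\mathrm{dist}_{p,D}(g_0,g_1)=\min\{(g_1-g_0)D^{ -1}\bmod p,\ (g_0-g_1)D^{ -1}\bmod p\}$, where each term is viewed as an integer in $\{0,\dots,p-1\}$ and $D^{ -1}$ is the inverse of $D$ modulo $p$.
   Formalization: The parameter ξ ranges only over the rationals in $(0,1)$. -}

module Defs where

open import Data.Nat using (ℕ; zero; suc; _*_; _∸_; _⊓_; NonZero)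
open import Data.Nat.DivMod using (_%_)
open import Data.Integer as ℤ using (ℤ; +_; _-_)
open import Data.Integer.DivMod using (_%ℕ_)
open import Data.Nat using (_≟_)
open import Data.List using (List; map; upTo; filter; length)
open import Data.Rational as ℚ using (ℚ; _/_; 1ℚ)
open import Data.Rational.Properties using (_<?_)
open import Relation.Nullary using (yes; no)

-- Least k in {0,…,n-1} with  (k * D) mod p = 1, searching upward from `from`;
-- returns the search bound if none exists (never happens when p is prime and p ∤ D).
findInv : (p : ℕ) .{{_ : NonZero p}} → ℤ → (from fuel : ℕ) → ℕ
findInv p D from zero = from
findInv p D from (suc fuel) with ((+ from) ℤ.* D) %ℕ p ≟ 1
... | yes _ = from
... | no  _ = findInv p D (suc from) fuel

invMod : (p : ℕ) .{{_ : NonZero p}} → ℤ → ℕ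
invMod p D = findInv p D 0 p

distPD : (p : ℕ) .{{_ : NonZero p}} → ℤ → ℕ → ℕ → ℕ
distPD p D g₀ g₁ =
  (((+ g₁ - + g₀) ℤ.* + invMod p D) %ℕ p) ⊓ (((+ g₀ - + g₁) ℤ.* + invMod p D) %ℕ p)

nonzeroResidues : ℕ → List ℕ
nonzeroResidues p = map suc (upTo (p ∸ 1))

goodCount : (p : ℕ) .{{_ : NonZero p}} → ℤ → ℚ → ℕ → ℕ → ℕ
goodCount p D ξ g g' =
  length (filter (λ c → ((1ℚ ℚ.- ξ) ℚ.* ((+ (p ∸ 1)) / 2)) <? ((+ distPD p D ((c * g) % p) ((c * g') % p)) / 1))
                 (nonzeroResidues p))

-- For c ≢ 0 put x c = c(g' − g)D⁻¹ mod p and y c = c(g − g')D⁻¹ mod p, so that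
-- dist(cg, cg') = min (x c) (y c). As g ≢ g' and D⁻¹ is a unit, x and y are
-- injective on the nonzero residues and never vanish there; hence the code
-- 2(min − 1) + [x c > y c], which records the minimum together with the side
-- attaining it, is injective and below 2·dist. A duplicate-free list of k
-- naturals has an element ≥ k − 1, so among k residues with
-- dist ≤ (1 − ξ)(p − 1)/2 one has k ≤ 2·dist ≤ (1 − ξ)(p − 1), and the remaining
-- (good) residues number at least ξ(p − 1).
module Submission where

open import Defs
open import Data.Nat as ℕ using (ℕ; zero; suc; _∸_; _<_; _≤_; NonZero; z≤n; s≤s)
import Data.Nat.Properties as ℕ
import Data.Nat.Divisibility as ℕ
open import Data.Nat.DivMod using (_%_)
open import Data.Nat.Primality using (Prime; euclidsLemma; prime⇒nonTrivial)
open import Data.Nat.Coprimality using (prime⇒coprime; coprime-Bézout; 1-coprimeTo)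
  renaming (sym to coprime-sym)
open import Data.Nat.GCD using (module Bézout)
open import Data.Integer as ℤ using (ℤ; +_; _-_; ∣_∣)
import Data.Integer.Properties as ℤ
open import Data.Integer.DivMod using (_%ℕ_; _/ℕ_; a≡a%ℕn+[a/ℕn]*n; n%ℕd<d)
open import Data.Integer.Divisibility.Signed
  using (_∣_; divides; ∣ᵤ⇒∣; ∣⇒∣ᵤ; ∣m⇒∣-m; ∣m∣n⇒∣m+n; ∣m∣n⇒∣m-n; ∣m⇒∣m*n; ∣n⇒∣m*n)
open import Data.Integer.Tactic.RingSolver using (solve-∀)
open import Data.Rational as ℚ using (ℚ; mkℚ; _/_; 0ℚ; 1ℚ; _*_; *≤*; toℚᵘ; NonNegative; nonNegative)
open import Data.Rational using () renaming (_<_ to _<ℚ_; _≤_ to _≤ℚ_)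
import Data.Rational.Properties as ℚ
open import Data.Rational.Properties using (_<?_)
import Data.Rational.Unnormalised as ℚᵘ
import Data.Rational.Unnormalised.Properties as ℚᵘ
open import Data.Rational.Solver using (module +-*-Solver)
open import Data.List using ([]; _∷_; length; filter; map; upTo)
import Data.List.Properties as List
open import Data.List.Relation.Unary.All as All using (All; []; _∷_; all?)
import Data.List.Relation.Unary.All.Properties as All
open import Data.List.Relation.Unary.Any as Any using (Any)
import Data.List.Relation.Unary.Any.Properties as Any
open import Data.List.Relation.Unary.AllPairs using ([]; _∷_)
open import Data.List.Relation.Unary.Unique.Propositional using (Unique)
import Data.List.Relation.Unary.Unique.Propositional.Properties as Unique
open import Data.Product using (∃; _×_; _,_; proj₁)
open import Data.Sum using (_⊎_; inj₁; inj₂; [_,_]′)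
import Data.Sum as Sum
open import Function using (_∘_)
open import Relation.Nullary using (¬_; yes; no; contradiction)
open import Relation.Unary using (Pred; Decidable)
open import Relation.Unary.Properties using (∁?)
open import Relation.Binary.PropositionalEquality

length-filter+length-filter-∁ : ∀ {a p} {A : Set a} {P : Pred A p} (P? : Decidable P) xs →
                               length (filter P? xs) ℕ.+ length (filter (∁? P?) xs) ≡ length xs
length-filter+length-filter-∁ P? []       = refl
length-filter+length-filter-∁ P? (x ∷ xs) with P? x
... | yes _ = cong suc (length-filter+length-filter-∁ P? xs)
... | no  _ = trans (ℕ.+-suc _ _) (cong suc (length-filter+length-filter-∁ P? xs))

Unique∧All<⇒length≤ : ∀ n {xs} → Unique xs → All (_< n) xs → length xs ≤ n
Unique∧All<⇒length≤ zero    {[]}    _    _         = z≤n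
Unique∧All<⇒length≤ zero    {_ ∷ _} _    (() ∷ _)
Unique∧All<⇒length≤ (suc m) {xs}    uniq all< = begin
  length xs                                       ≡⟨ length-filter+length-filter-∁ (ℕ._<? m) xs ⟨
  length (filter (ℕ._<? m) xs) ℕ.+ length rest    ≤⟨ ℕ.+-mono-≤ below (atMostOne rest rest-unique rest≡m) ⟩
  m ℕ.+ 1                                         ≡⟨ ℕ.+-comm m 1 ⟩
  suc m                                           ∎
  where
  open ℕ.≤-Reasoning
  rest = filter (∁? (ℕ._<? m)) xs
  below : length (filter (ℕ._<? m) xs) ≤ m
  below = Unique∧All<⇒length≤ m (Unique.filter⁺ (ℕ._<? m) uniq) (All.all-filter (ℕ._<? m) xs)
  rest-unique : Unique rest
  rest-unique = Unique.filter⁺ (∁? (ℕ._<? m)) uniq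
  rest≡m : All (_≡ m) rest
  rest≡m = All.zipWith (λ (x≮m , x<1+m) → ℕ.≤-antisym (ℕ.≤-pred x<1+m) (ℕ.≮⇒≥ x≮m))
                       (All.all-filter (∁? (ℕ._<? m)) xs , All.filter⁺ (∁? (ℕ._<? m)) all<)
  atMostOne : ∀ ys → Unique ys → All (_≡ m) ys → length ys ≤ 1
  atMostOne []          _               _               = z≤n
  atMostOne (_ ∷ [])    _               _               = s≤s z≤n
  atMostOne (_ ∷ _ ∷ _) ((y≢z ∷ _) ∷ _) (y≡m ∷ z≡m ∷ _) = contradiction (trans y≡m (sym z≡m)) y≢z

Unique⇒Any-length≤ : ∀ {x xs} → Unique (x ∷ xs) → Any (length xs ≤_) (x ∷ xs)
Unique⇒Any-length≤ {x} {xs} uniq with all? (ℕ._<? length xs) (x ∷ xs)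
... | yes all< = contradiction (Unique∧All<⇒length≤ (length xs) uniq all<) (ℕ.n≮n (length xs))
... | no ¬all< = Any.map ℕ.≮⇒≥ (All.¬All⇒Any¬ (ℕ._<? length xs) (x ∷ xs) ¬all<)

Unique-map⁺-injectiveOn : ∀ {a b p} {A : Set a} {B : Set b} {P : Pred A p} {f : A → B} →
                          (∀ {x y} → P x → P y → f x ≡ f y → x ≡ y) →
                          ∀ {xs} → All P xs → Unique xs → Unique (map f xs)
Unique-map⁺-injectiveOn inj []         []            = []
Unique-map⁺-injectiveOn inj (px ∷ pxs) (x∉xs ∷ uniq) =
  All.map⁺ (All.zipWith (λ (py , x≢y) → x≢y ∘ inj px py) (pxs , x∉xs)) ∷ Unique-map⁺-injectiveOn inj pxs uniq

minCode : ℕ → ℕ → ℕ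
minCode x y with x ℕ.≤? y
... | yes _ = 2 ℕ.* ℕ.pred x
... | no  _ = suc (2 ℕ.* ℕ.pred y)

minCode<2*⊓ : ∀ {x y} → x ≢ 0 → y ≢ 0 → minCode x y < 2 ℕ.* (x ℕ.⊓ y)
minCode<2*⊓ {zero}          x≢0 _   = contradiction refl x≢0
minCode<2*⊓ {_}     {zero}  _   y≢0 = contradiction refl y≢0
minCode<2*⊓ {suc a} {suc b} _   _   with suc a ℕ.≤? suc b
... | yes a≤b rewrite ℕ.m≤n⇒m⊓n≡m (ℕ.≤-pred a≤b)           = s≤s (ℕ.+-monoʳ-≤ a (ℕ.n≤1+n _))
... | no  a≰b rewrite ℕ.m≥n⇒m⊓n≡n (ℕ.≤-pred (ℕ.≰⇒≥ a≰b)) = s≤s (ℕ.≤-reflexive (sym (ℕ.+-suc b _)))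

minCode-injective : ∀ {x y x′ y′} → x ≢ 0 → y ≢ 0 → x′ ≢ 0 → y′ ≢ 0 →
                    minCode x y ≡ minCode x′ y′ → x ≡ x′ ⊎ y ≡ y′
minCode-injective {zero}                     x≢0 _   _    _    _ = contradiction refl x≢0
minCode-injective {_}    {zero}              _   y≢0 _    _    _ = contradiction refl y≢0
minCode-injective {_}    {_}    {zero}       _   _   x′≢0 _    _ = contradiction refl x′≢0
minCode-injective {_}    {_}    {_}   {zero} _   _   _    y′≢0 _ = contradiction refl y′≢0
minCode-injective {suc a} {suc b} {suc a′} {suc b′} _ _ _ _ eq
  with suc a ℕ.≤? suc b | suc a′ ℕ.≤? suc b′
... | yes _ | yes _ = inj₁ (cong suc (ℕ.*-cancelˡ-≡ a a′ 2 eq))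
... | yes _ | no  _ = contradiction eq (ℕ.even≢odd a b′)
... | no  _ | yes _ = contradiction (sym eq) (ℕ.even≢odd a′ b)
... | no  _ | no  _ = inj₂ (cong suc (ℕ.*-cancelˡ-≡ b b′ 2 (ℕ.suc-injective eq)))

fromℕ : ℕ → ℚ
fromℕ n = + n / 1

private
  fromℕ-mkℚ : ∀ n → fromℕ n ≡ mkℚ (+ n) 0 (coprime-sym (1-coprimeTo n))
  fromℕ-mkℚ n = ℚ.normalize-coprime (coprime-sym (1-coprimeTo n))

fromℕ-mono-≤ : ∀ {m n} → m ≤ n → fromℕ m ≤ℚ fromℕ n
fromℕ-mono-≤ {m} {n} m≤n rewrite fromℕ-mkℚ m | fromℕ-mkℚ n =
  *≤* (subst₂ ℤ._≤_ (sym (ℤ.*-identityʳ (+ m))) (sym (ℤ.*-identityʳ (+ n))) (ℤ.+≤+ m≤n))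

fromℕ-homo-+ : ∀ m n → fromℕ (m ℕ.+ n) ≡ fromℕ m ℚ.+ fromℕ n
fromℕ-homo-+ m n = ℚ.toℚᵘ-injective (ℚᵘ.≃-trans sum (ℚᵘ.≃-sym (ℚ.toℚᵘ-homo-+ (fromℕ m) (fromℕ n))))
  where
  lemma : ∀ x y → (x ℤ.+ y) ℤ.* + 1 ≡ (x ℤ.* + 1 ℤ.+ y ℤ.* + 1) ℤ.* + 1
  lemma = solve-∀
  sum : toℚᵘ (fromℕ (m ℕ.+ n)) ℚᵘ.≃ toℚᵘ (fromℕ m) ℚᵘ.+ toℚᵘ (fromℕ n)
  sum rewrite fromℕ-mkℚ m | fromℕ-mkℚ n | fromℕ-mkℚ (m ℕ.+ n) =
    ℚᵘ.*≡* (trans (cong (ℤ._* + 1) (ℤ.pos-+ m n)) (lemma (+ m) (+ n)))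

half+half : ∀ n → + n / 2 ℚ.+ + n / 2 ≡ fromℕ n
half+half n = ℚ.toℚᵘ-injective (ℚᵘ.≃-trans (ℚ.toℚᵘ-homo-+ (+ n / 2) (+ n / 2))
                (ℚᵘ.≃-trans (ℚᵘ.+-cong half half) sum))
  where
  half : toℚᵘ (+ n / 2) ℚᵘ.≃ ℚᵘ.mkℚᵘ (+ n) 1
  half = ℚ.toℚᵘ-fromℚᵘ (ℚᵘ.mkℚᵘ (+ n) 1)
  lemma : ∀ x → (x ℤ.* + 2 ℤ.+ x ℤ.* + 2) ℤ.* + 1 ≡ x ℤ.* + 4
  lemma = solve-∀
  sum : ℚᵘ.mkℚᵘ (+ n) 1 ℚᵘ.+ ℚᵘ.mkℚᵘ (+ n) 1 ℚᵘ.≃ toℚᵘ (fromℕ n)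
  sum rewrite fromℕ-mkℚ n = ℚᵘ.*≡* (lemma (+ n))

k≤2d∧d≤cn/2⇒k≤cn : ∀ c k d n → k ≤ 2 ℕ.* d → fromℕ d ≤ℚ c * (+ n / 2) → fromℕ k ≤ℚ c * fromℕ n
k≤2d∧d≤cn/2⇒k≤cn c k d n k≤2d d≤cn/2 = begin
  fromℕ k                           ≤⟨ fromℕ-mono-≤ k≤2d ⟩
  fromℕ (d ℕ.+ (d ℕ.+ 0))           ≡⟨ cong (fromℕ ∘ (d ℕ.+_)) (ℕ.+-identityʳ d) ⟩
  fromℕ (d ℕ.+ d)                   ≡⟨ fromℕ-homo-+ d d ⟩
  fromℕ d ℚ.+ fromℕ d               ≤⟨ ℚ.+-mono-≤ d≤cn/2 d≤cn/2 ⟩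
  c * (+ n / 2) ℚ.+ c * (+ n / 2)   ≡⟨ ℚ.*-distribˡ-+ c (+ n / 2) (+ n / 2) ⟨
  c * (+ n / 2 ℚ.+ + n / 2)         ≡⟨ cong (c *_) (half+half n) ⟩
  c * fromℕ n                       ∎
  where open ℚ.≤-Reasoning

g+k≡n∧k≤[1-ξ]n⇒ξn≤g : ∀ ξ g k n → g ℕ.+ k ≡ n → fromℕ k ≤ℚ (1ℚ ℚ.- ξ) * fromℕ n → ξ * fromℕ n ≤ℚ fromℕ g
g+k≡n∧k≤[1-ξ]n⇒ξn≤g ξ g k n g+k≡n k≤[1-ξ]n = begin
  ξ * fromℕ n                          ≡⟨ solve 2 (λ x m → x :* m := m :- (con 1ℚ :- x) :* m) refl ξ (fromℕ n) ⟩
  fromℕ n ℚ.- (1ℚ ℚ.- ξ) * fromℕ n     ≤⟨ ℚ.+-monoʳ-≤ (fromℕ n) (ℚ.neg-antimono-≤ k≤[1-ξ]n) ⟩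
  fromℕ n ℚ.- fromℕ k                  ≡⟨ cong (ℚ._- fromℕ k) (trans (cong fromℕ (sym g+k≡n)) (fromℕ-homo-+ g k)) ⟩
  fromℕ g ℚ.+ fromℕ k ℚ.- fromℕ k      ≡⟨ solve 2 (λ a b → a :+ b :- b := a) refl (fromℕ g) (fromℕ k) ⟩
  fromℕ g                              ∎
  where open ℚ.≤-Reasoning
        open +-*-Solver

ξ≤1⇒0≤[1-ξ]n : ∀ {ξ} → ξ ≤ℚ 1ℚ → ∀ n → 0ℚ ≤ℚ (1ℚ ℚ.- ξ) * fromℕ n
ξ≤1⇒0≤[1-ξ]n {ξ} ξ≤1 n = ℚ.nonNegative⁻¹ _ {{ℚ.nonNeg*nonNeg⇒nonNeg (1ℚ ℚ.- ξ) {{0≤1-ξ}} (fromℕ n) {{0≤n}}}}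
  where
  0≤1-ξ : NonNegative (1ℚ ℚ.- ξ)
  0≤1-ξ = nonNegative {1ℚ ℚ.- ξ} (ℚ.+-monoʳ-≤ 1ℚ (ℚ.neg-antimono-≤ ξ≤1))
  0≤n : NonNegative (fromℕ n)
  0≤n = nonNegative {fromℕ n} (fromℕ-mono-≤ {0} {n} z≤n)

module Modulo (p : ℕ) where

  infix 4 _≈_
  record _≈_ (a b : ℤ) : Set where
    constructor mk≈
    field ∣-diff : + p ∣ a - b
  open _≈_

  private
    ∣-resp : ∀ {a b} → a ≡ b → + p ∣ a → + p ∣ b
    ∣-resp = subst (+ p ∣_)

  ≈-refl : ∀ {a} → a ≈ a
  ≈-refl {a} = mk≈ (divides (+ 0) (ℤ.+-inverseʳ a))

  ≈-sym : ∀ {a b} → a ≈ b → b ≈ a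
  ≈-sym {a} {b} (mk≈ ab) = mk≈ (∣-resp (lemma a b) (∣m⇒∣-m ab))
    where lemma : ∀ a b → ℤ.- (a - b) ≡ b - a
          lemma = solve-∀

  ≈-trans : ∀ {a b c} → a ≈ b → b ≈ c → a ≈ c
  ≈-trans {a} {b} {c} (mk≈ ab) (mk≈ bc) = mk≈ (∣-resp (lemma a b c) (∣m∣n⇒∣m+n ab bc))
    where lemma : ∀ a b c → (a - b) ℤ.+ (b - c) ≡ a - c
          lemma = solve-∀

  -‿cong : ∀ {a b c d} → a ≈ b → c ≈ d → a - c ≈ b - d
  -‿cong {a} {b} {c} {d} (mk≈ ab) (mk≈ cd) = mk≈ (∣-resp (lemma a b c d) (∣m∣n⇒∣m-n ab cd))
    where lemma : ∀ a b c d → (a - b) - (c - d) ≡ (a - c) - (b - d)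
          lemma = solve-∀

  *-cong : ∀ {a b c d} → a ≈ b → c ≈ d → a ℤ.* c ≈ b ℤ.* d
  *-cong {a} {b} {c} {d} (mk≈ ab) (mk≈ cd) =
    mk≈ (∣-resp (lemma a b c d) (∣m∣n⇒∣m+n (∣m⇒∣m*n c ab) (∣n⇒∣m*n b cd)))
    where lemma : ∀ a b c d → (a - b) ℤ.* c ℤ.+ b ℤ.* (c - d) ≡ a ℤ.* c - b ℤ.* d
          lemma = solve-∀

  ∣⇒≈0 : ∀ {a} → + p ∣ a → a ≈ + 0
  ∣⇒≈0 {a} = mk≈ ∘ ∣-resp (sym (ℤ.+-identityʳ a))

  p∣i∧∣i∣<p⇒i≡0 : ∀ {i} → + p ∣ i → ∣ i ∣ < p → i ≡ + 0
  p∣i∧∣i∣<p⇒i≡0 {i} p∣i ∣i∣<p with ∣ i ∣ in eq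
  ... | zero  = ℤ.∣i∣≡0⇒i≡0 eq
  ... | suc _ = contradiction (subst (p ℕ.∣_) eq (∣⇒∣ᵤ p∣i)) (ℕ.>⇒∤ ∣i∣<p)

  +≈+⇒≡ : ∀ {a b} → a < p → b < p → + a ≈ + b → a ≡ b
  +≈+⇒≡ {a} {b} a<p b<p a≈b = ℤ.+-injective (ℤ.i-j≡0⇒i≡j (+ a) (+ b) (p∣i∧∣i∣<p⇒i≡0 (∣-diff a≈b) ∣a-b∣<p))
    where
    ∣a-b∣<p : ∣ + a - + b ∣ < p
    ∣a-b∣<p = ℕ.≤-<-trans (subst (_≤ a ℕ.⊔ b) (cong ∣_∣ (sym (ℤ.[+m]-[+n]≡m⊖n a b))) (ℤ.∣m⊝n∣≤m⊔n a b))
                          (ℕ.⊔-lub a<p b<p)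

  module _ .{{_ : NonZero p}} where

    %ℕ-≈ : ∀ z → + (z %ℕ p) ≈ z
    %ℕ-≈ z = mk≈ (divides (ℤ.- (z /ℕ p)) (lemma (+ (z %ℕ p)) (z /ℕ p) (+ p) z (a≡a%ℕn+[a/ℕn]*n z p)))
      where lemma : ∀ r q n z → z ≡ r ℤ.+ q ℤ.* n → r - z ≡ ℤ.- q ℤ.* n
            lemma r q n z refl = normalise r q n
              where normalise : ∀ r q n → r - (r ℤ.+ q ℤ.* n) ≡ ℤ.- q ℤ.* n
                    normalise = solve-∀

    ≈⇒%ℕ≡ : ∀ {z r} → z ≈ + r → r < p → z %ℕ p ≡ r
    ≈⇒%ℕ≡ {z} z≈r r<p = +≈+⇒≡ (n%ℕd<d z p) r<p (≈-trans (%ℕ-≈ z) z≈r)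

  module _ (prime : Prime p) where

    euclidsLemmaℤ : ∀ a b → + p ∣ a ℤ.* b → (+ p ∣ a) ⊎ (+ p ∣ b)
    euclidsLemmaℤ a b p∣ab =
      Sum.map (∣ᵤ⇒∣ {+ p} {a}) (∣ᵤ⇒∣ {+ p} {b})
              (euclidsLemma ∣ a ∣ ∣ b ∣ prime (subst (p ℕ.∣_) (ℤ.abs-* a b) (∣⇒∣ᵤ p∣ab)))

    *-cancelʳ-≈ : ∀ {k} → ¬ (+ p ∣ k) → ∀ {a b} → a ℤ.* k ≈ b ℤ.* k → a ≈ b
    *-cancelʳ-≈ {k} p∤k {a} {b} ak≈bk =
      [ mk≈ , (λ p∣k → contradiction p∣k p∤k) ]′
        (euclidsLemmaℤ (a - b) k (subst (+ p ∣_) (lemma a b k) (∣-diff ak≈bk)))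
      where lemma : ∀ a b k → a ℤ.* k - b ℤ.* k ≡ (a - b) ℤ.* k
            lemma = solve-∀

module _ (p : ℕ) .{{_ : NonZero p}} (D : ℤ) where

  findInv-complete : ∀ from fuel {k} → from ≤ k → k < from ℕ.+ fuel → (+ k ℤ.* D) %ℕ p ≡ 1 →
                     (+ findInv p D from fuel ℤ.* D) %ℕ p ≡ 1
  findInv-complete from zero       from≤k k<from+0 _ =
    contradiction (subst (_ <_) (ℕ.+-identityʳ from) k<from+0) (ℕ.≤⇒≯ from≤k)
  findInv-complete from (suc fuel) {k} from≤k k<from+1+fuel kD≡1 with (+ from ℤ.* D) %ℕ p ℕ.≟ 1
  ... | yes fromD≡1 = fromD≡1
  ... | no  fromD≢1 with ℕ.m≤n⇒m<n∨m≡n from≤k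
  ...   | inj₁ from<k = findInv-complete (suc from) fuel from<k (subst (k <_) (ℕ.+-suc from fuel) k<from+1+fuel) kD≡1
  ...   | inj₂ refl   = contradiction kD≡1 fromD≢1

  -- (cu − cv)D⁻¹ mod p; by definition distPD p D (cg % p) (cg' % p) is
  -- scaledDiff g' g c ⊓ scaledDiff g g' c.
  scaledDiff : ℕ → ℕ → ℕ → ℕ
  scaledDiff u v c = ((+ (c ℕ.* u % p) - + (c ℕ.* v % p)) ℤ.* + invMod p D) %ℕ p

module _ (p : ℕ) .{{_ : NonZero p}} (prime : Prime p) (D : ℤ) (p∤D : D %ℕ p ≢ 0) where

  open Modulo p

  private
    d : ℕ
    d = D %ℕ p

    ℕ-identity⇒ℤ : ∀ a b c e → 1 ℕ.+ a ℕ.* b ≡ c ℕ.* e → + 1 ℤ.+ + a ℤ.* + b ≡ + c ℤ.* + e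
    ℕ-identity⇒ℤ a b c e eq = begin
      + 1 ℤ.+ + a ℤ.* + b    ≡⟨ cong (ℤ._+_ (+ 1)) (ℤ.pos-* a b) ⟨
      + (1 ℕ.+ a ℕ.* b)      ≡⟨ cong +_ eq ⟩
      + (c ℕ.* e)            ≡⟨ ℤ.pos-* c e ⟩
      + c ℤ.* + e            ∎
      where open ≡-Reasoning

  ∃-inverseℤ : ∃ λ z → z ℤ.* + d ≈ + 1
  ∃-inverseℤ with coprime-Bézout (prime⇒coprime prime {{ℕ.≢-nonZero p∤D}} (n%ℕd<d D p))
  ... | Bézout.+- x y eq = ℤ.- + y , mk≈ (divides (ℤ.- + x) (begin
    ℤ.- + y ℤ.* + d - + 1        ≡⟨ lemma (+ y) (+ d) ⟩
    ℤ.- (+ 1 ℤ.+ + y ℤ.* + d)    ≡⟨ cong ℤ.-_ (ℕ-identity⇒ℤ y d x p eq) ⟩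
    ℤ.- (+ x ℤ.* + p)            ≡⟨ ℤ.neg-distribˡ-* (+ x) (+ p) ⟩
    ℤ.- + x ℤ.* + p              ∎))
    where open ≡-Reasoning
          lemma : ∀ y d → ℤ.- y ℤ.* d - + 1 ≡ ℤ.- (+ 1 ℤ.+ y ℤ.* d)
          lemma = solve-∀
  ... | Bézout.-+ x y eq = + y , mk≈ (divides (+ x) (begin
    + y ℤ.* + d - + 1            ≡⟨ cong (_- + 1) (ℕ-identity⇒ℤ x p y d eq) ⟨
    + 1 ℤ.+ + x ℤ.* + p - + 1    ≡⟨ lemma (+ x ℤ.* + p) ⟩
    + x ℤ.* + p                  ∎))
    where open ≡-Reasoning
          lemma : ∀ a → + 1 ℤ.+ a - + 1 ≡ a
          lemma = solve-∀

  private
    1<p : 1 < p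
    1<p = ℕ.nonTrivial⇒n>1 p {{prime⇒nonTrivial prime}}

  ∃-inverse<p : ∃ λ k → k < p × (+ k ℤ.* D) %ℕ p ≡ 1
  ∃-inverse<p with z , zd≈1 ← ∃-inverseℤ =
    z %ℕ p , n%ℕd<d z p , ≈⇒%ℕ≡ (≈-trans (*-cong (%ℕ-≈ z) (≈-sym (%ℕ-≈ D))) zd≈1) 1<p

  invMod-correct : (+ invMod p D ℤ.* D) %ℕ p ≡ 1
  invMod-correct = let k , k<p , kD≡1 = ∃-inverse<p in findInv-complete p D 0 p z≤n k<p kD≡1

  p∤invMod : ¬ (+ p ∣ + invMod p D)
  p∤invMod p∣inv = ℕ.1+n≢0 (trans (sym invMod-correct)
    (≈⇒%ℕ≡ (*-cong (∣⇒≈0 p∣inv) (≈-refl {D})) (ℕ.<-trans ℕ.z<s 1<p)))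

  module _ {u v : ℕ} (u<p : u < p) (v<p : v < p) (u≢v : u ≢ v) where

    private
      K : ℤ
      K = (+ u - + v) ℤ.* + invMod p D

      p∤K : ¬ (+ p ∣ K)
      p∤K p∣K = [ u≢v ∘ +≈+⇒≡ u<p v<p ∘ mk≈ , p∤invMod ]′ (euclidsLemmaℤ prime (+ u - + v) (+ invMod p D) p∣K)

    scaledDiff-≈ : ∀ c → + scaledDiff p D u v c ≈ + c ℤ.* K
    scaledDiff-≈ c = ≈-trans (%ℕ-≈ diff) (subst (diff ≈_) (lemma (+ c) (+ u) (+ v) (+ invMod p D))
      (*-cong (-‿cong (residue u) (residue v)) (≈-refl {+ invMod p D})))
      where
      diff : ℤ
      diff = (+ (c ℕ.* u % p) - + (c ℕ.* v % p)) ℤ.* + invMod p D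
      residue : ∀ w → + (c ℕ.* w % p) ≈ + c ℤ.* + w
      residue w = subst (+ (c ℕ.* w % p) ≈_) (ℤ.pos-* c w) (%ℕ-≈ (+ (c ℕ.* w)))
      lemma : ∀ c u v i → (c ℤ.* u - c ℤ.* v) ℤ.* i ≡ c ℤ.* ((u - v) ℤ.* i)
      lemma = solve-∀

    scaledDiff-injective : ∀ {c₁ c₂} → c₁ < p → c₂ < p → scaledDiff p D u v c₁ ≡ scaledDiff p D u v c₂ → c₁ ≡ c₂
    scaledDiff-injective {c₁} {c₂} c₁<p c₂<p eq = +≈+⇒≡ c₁<p c₂<p (*-cancelʳ-≈ prime p∤K
      (≈-trans (≈-sym (scaledDiff-≈ c₁)) (subst (λ r → + r ≈ + c₂ ℤ.* K) (sym eq) (scaledDiff-≈ c₂))))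

    scaledDiff≢0 : ∀ {c} → 0 < c → c < p → scaledDiff p D u v c ≢ 0
    scaledDiff≢0 {c} 0<c c<p eq = ℕ.<⇒≢ 0<c (sym (+≈+⇒≡ c<p (ℕ.<-trans 0<c c<p) (*-cancelʳ-≈ prime p∤K
      (≈-trans (≈-sym (scaledDiff-≈ c)) (subst (λ r → + r ≈ + 0) (sym eq) ≈-refl)))))

IsNonzeroResidue : ℕ → ℕ → Set
IsNonzeroResidue p c = 0 < c × c < p

nonzeroResidues-sound : ∀ p .{{_ : NonZero p}} → All (IsNonzeroResidue p) (nonzeroResidues p)
nonzeroResidues-sound p = All.map⁺ (All.applyUpTo⁺₁ _ (p ∸ 1) λ i<p-1 →
  s≤s z≤n , ℕ.≤-trans (s≤s i<p-1) (ℕ.≤-reflexive (ℕ.suc-pred p)))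

nonzeroResidues-unique : ∀ p → Unique (nonzeroResidues p)
nonzeroResidues-unique p = Unique.map⁺ ℕ.suc-injective (Unique.upTo⁺ (p ∸ 1))

module _ (p : ℕ) .{{_ : NonZero p}} (prime : Prime p) (D : ℤ) (p∤D : D %ℕ p ≢ 0)
         {g g′ : ℕ} (g<p : g < p) (g′<p : g′ < p) (g≢g′ : g ≢ g′) where

  private
    dist x y : ℕ → ℕ
    dist c = distPD p D (c ℕ.* g % p) (c ℕ.* g′ % p)
    x = scaledDiff p D g′ g
    y = scaledDiff p D g g′

    x≢0 : ∀ {c} → IsNonzeroResidue p c → x c ≢ 0
    x≢0 (0<c , c<p) = scaledDiff≢0 p prime D p∤D g′<p g<p (g≢g′ ∘ sym) 0<c c<p

    y≢0 : ∀ {c} → IsNonzeroResidue p c → y c ≢ 0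
    y≢0 (0<c , c<p) = scaledDiff≢0 p prime D p∤D g<p g′<p g≢g′ 0<c c<p

    code : ℕ → ℕ
    code c = minCode (x c) (y c)

    code-injective : ∀ {c c′} → IsNonzeroResidue p c → IsNonzeroResidue p c′ → code c ≡ code c′ → c ≡ c′
    code-injective r@(_ , c<p) r′@(_ , c′<p) eq =
      [ scaledDiff-injective p prime D p∤D g′<p g<p (g≢g′ ∘ sym) c<p c′<p
      , scaledDiff-injective p prime D p∤D g<p g′<p g≢g′ c<p c′<p
      ]′ (minCode-injective (x≢0 r) (y≢0 r) (x≢0 r′) (y≢0 r′) eq)

    code<2*dist : ∀ {c} → IsNonzeroResidue p c → code c < 2 ℕ.* dist c
    code<2*dist r = minCode<2*⊓ (x≢0 r) (y≢0 r)

  close-residues-bound :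
    ∀ {ξ} → ξ ≤ℚ 1ℚ → ∀ n cs → Unique cs →
    All (λ c → IsNonzeroResidue p c × fromℕ (dist c) ≤ℚ (1ℚ ℚ.- ξ) * (+ n / 2)) cs →
    fromℕ (length cs) ≤ℚ (1ℚ ℚ.- ξ) * fromℕ n
  close-residues-bound     ξ≤1 n []       _    _     = ξ≤1⇒0≤[1-ξ]n ξ≤1 n
  close-residues-bound {ξ} ξ≤1 n (c ∷ cs) uniq close =
    All.lookupWith long⇒bound close
      (Any.map⁻ (Unique⇒Any-length≤ (Unique-map⁺-injectiveOn code-injective (All.map proj₁ close) uniq)))
    where
    long⇒bound : ∀ {c′} → IsNonzeroResidue p c′ × fromℕ (dist c′) ≤ℚ (1ℚ ℚ.- ξ) * (+ n / 2) →
                 length (map code cs) ≤ code c′ → fromℕ (length (c ∷ cs)) ≤ℚ (1ℚ ℚ.- ξ) * fromℕ n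
    long⇒bound {c′} (res , dist≤) long = k≤2d∧d≤cn/2⇒k≤cn (1ℚ ℚ.- ξ) (length (c ∷ cs)) (dist c′) n
      (ℕ.≤-trans (s≤s (subst (_≤ code c′) (List.length-map code cs) long)) (code<2*dist res)) dist≤

lemma14 : (p : ℕ) .{{_ : NonZero p}} → Prime p → 2 < p →
    (D : ℤ) → D %ℕ p ≢ 0 →
    (ξ : ℚ) → 0ℚ <ℚ ξ → ξ <ℚ 1ℚ →
    (g g' : ℕ) → g < p → g' < p → g ≢ g' →
    ξ * ((+ (p ∸ 1)) / 1) ≤ℚ (+ goodCount p D ξ g g') / 1
lemma14 p p-prime _ D p∤D ξ _ ξ<1 g g′ g<p g′<p g≢g′ =
  g+k≡n∧k≤[1-ξ]n⇒ξn≤g ξ (goodCount p D ξ g g′) (length bad) N partition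
    (close-residues-bound p p-prime D p∤D g<p g′<p g≢g′ (ℚ.<⇒≤ ξ<1) N bad bad-unique bad-close)
  where
  N = p ∸ 1
  dist : ℕ → ℕ
  dist c = distPD p D (c ℕ.* g % p) (c ℕ.* g′ % p)
  good? : Decidable (λ c → (1ℚ ℚ.- ξ) * (+ N / 2) <ℚ fromℕ (dist c))
  good? c = (1ℚ ℚ.- ξ) * (+ N / 2) <? fromℕ (dist c)
  bad = filter (∁? good?) (nonzeroResidues p)
  partition : goodCount p D ξ g g′ ℕ.+ length bad ≡ N
  partition = trans (length-filter+length-filter-∁ good? (nonzeroResidues p))
                    (trans (List.length-map suc (upTo N)) (List.length-upTo N))
  bad-unique : Unique bad
  bad-unique = Unique.filter⁺ (∁? good?) (nonzeroResidues-unique p)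
  bad-close : All (λ c → IsNonzeroResidue p c × fromℕ (dist c) ≤ℚ (1ℚ ℚ.- ξ) * (+ N / 2)) bad
  bad-close = All.zip (All.filter⁺ (∁? good?) (nonzeroResidues-sound p)
                      , All.map ℚ.≮⇒≥ (All.all-filter (∁? good?) (nonzeroResidues p)))
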